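{- Let $\lambda\in(0,1)$ and let $\Pi$ be a strongly $\lambda$-extendible property on a graph class $\mathcal{G}$. If $\lambda\neq\frac{1}{2}$ or $K_3\in\Pi$, then $\mathrm{ex}(K_i)>0$ for all integers $i\geq 2$.
   Context: $\mathcal{G}$ is a class of graphs whose edges may carry orientations and/or labels from a finite set. For $G\in\mathcal{G}$, $U(G)$ denotes the underlying simple graph; subgraphs inherit orientations/labels. A graph property $\Pi$ is a subset of $\mathcal{G}$ closed under isomorphism; "$K_3\in\Pi$" means every $G\in\mathcal{G}$ with $U(G)=K_3$ belongs to $\Pi$. For $\lambda\in(0,1)$, $\Pi$ is strongly $\lambda$-extendible if: (inclusiveness) every $G\in\mathcal{G}$ with $U(G)\in\{K_1,K_2\}$ is in $\Pi$; (block additivity) $G\in\Pi$ iff every block of $G$ is in $\Pi$; (strong $\lambda$-subgraph extension) for every $G\in\mathcal{G}$ and every partition $(U,W)$ of $V(G)$ with $G[U],G[W]\in\Pi$, there is a set $F$ of edges between $U$ and $W$ with $|F|\geq\lambda|E(U,W)|$ such that $G-(E(U,W)\setminus F)\in\Pi$. For $G\in\mathcal{G}$, $\beta(G)$ is the maximum number of edges of a subgraph of $G$ belonging to $\Pi$. For the simple graph $K_j$, $\beta(K_j)=\min\{\beta(G):G\in\mathcal{G},U(G)=K_j\}$ and $\mathrm{ex}(K_j)=\beta(K_j)-\big(\lambda\binom{j}{2}+\frac{1-\lambda}{2}(j-1)\big)$. -}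

module Defs where

open import Data.Nat as ℕ using (ℕ; zero; suc; _<ᵇ_)
open import Data.Fin as Fin using (Fin; toℕ; _≟_)
open import Data.Bool using (Bool; true; false; _∧_; not; _xor_; if_then_else_)
open import Data.Maybe as Maybe using (Maybe; just; nothing; is-just)
open import Data.List using (List; allFin; map)
open import Data.Nat.ListAction using (sum)
open import Data.Integer using (+_)
open import Data.Rational as ℚ using (ℚ; 0ℚ; 1ℚ; ½)
open import Data.Product using (Σ; _×_; _,_; ∃)
open import Data.Sum using (_⊎_)
open import Data.Empty using (⊥)
open import Relation.Nullary using (¬_; does)
open import Relation.Binary.PropositionalEquality using (_≡_; _≢_; refl; sym; trans; cong)

-- Real numbers (Dedekind cuts of ℚ); only used for the parameter λ.
-- L q means q < x, U q means x < q.

record ℝ : Set₁ where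
  field
    L U       : ℚ → Set
    L-inhab   : ∃ λ q → L q
    U-inhab   : ∃ λ q → U q
    L-rounded : ∀ q → L q → ∃ λ r → (q ℚ.< r) × L r
    L-down    : ∀ q r → q ℚ.< r → L r → L q
    U-rounded : ∀ q → U q → ∃ λ r → (r ℚ.< q) × U r
    U-up      : ∀ q r → q ℚ.< r → U q → U r
    disjoint  : ∀ q → L q → U q → ⊥
    located   : ∀ q r → q ℚ.< r → L q ⊎ U r

open ℝ public

ℕ→ℚ : ℕ → ℚ
ℕ→ℚ m = + m ℚ./ 1

InOpenUnit : ℝ → Set
InOpenUnit x = L x 0ℚ × U x 1ℚ

-- x ≠ ½ (apartness, the constructive inequality of reals)
Apart½ : ℝ → Set
Apart½ x = L x ½ ⊎ U x ½

-- x · m ≤ k   (m, k natural numbers)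
MulLe : ℝ → ℕ → ℕ → Set
MulLe x m k = ∀ q → L x q → q ℚ.* ℕ→ℚ m ℚ.≤ ℕ→ℚ k

-- Graphs of the class 𝒢: vertex set a subset V of Fin n, at most one
-- edge between two distinct vertices, each edge carrying a decoration
-- from the finite set Fin k (orientation and/or label).  E u v is the
-- decoration seen from u; seen from v it is  flip d  (flip an involution,
-- e.g. reversing the orientation; flip = id for undirected labels).

module _ {k : ℕ} (flip : Fin k → Fin k) where

  record Graph (n : ℕ) : Set where
    field
      V      : Fin n → Bool
      E      : Fin n → Fin n → Maybe (Fin k)
      irrefl : ∀ u → E u u ≡ nothing
      E-sym  : ∀ u v → E v u ≡ Maybe.map flip (E u v)
      E-V    : ∀ u v d → E u v ≡ just d → V u ≡ true

  open Graph public

  edgeCount : ∀ {n} → Graph n → ℕ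
  edgeCount {n} G = sum (map (λ u → sum (map (λ v →
    if (toℕ u <ᵇ toℕ v) ∧ is-just (E G u v) then 1 else 0) (allFin n))) (allFin n))

  vertexCount : ∀ {n} → Graph n → ℕ
  vertexCount {n} G = sum (map (λ u → if V G u then 1 else 0) (allFin n))

  crossCount : ∀ {n} → Graph n → (Fin n → Bool) → ℕ
  crossCount {n} G side = sum (map (λ u → sum (map (λ v →
    if (toℕ u <ᵇ toℕ v) ∧ (side u xor side v) ∧ is-just (E G u v) then 1 else 0)
      (allFin n))) (allFin n))

  record Iso {n m : ℕ} (G : Graph n) (H : Graph m) : Set where
    field
      f   : Fin n → Fin m
      g   : Fin m → Fin n
      f-V : ∀ u → V G u ≡ true → V H (f u) ≡ true
      g-V : ∀ w → V H w ≡ true → V G (g w) ≡ true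
      gf  : ∀ u → V G u ≡ true → g (f u) ≡ u
      fg  : ∀ w → V H w ≡ true → f (g w) ≡ w
      f-E : ∀ u v → V G u ≡ true → V G v ≡ true → E H (f u) (f v) ≡ E G u v

  Property : Set₁
  Property = ∀ {n} → Graph n → Set

  IsoClosed : Property → Set
  IsoClosed Π = ∀ {n m} (G : Graph n) (H : Graph m) → Iso G H → Π G → Π H

  record _⊑_ {n : ℕ} (H G : Graph n) : Set where
    field
      V⊆ : ∀ u → V H u ≡ true → V G u ≡ true
      E⊆ : ∀ u v d → E H u v ≡ just d → E G u v ≡ just d

  private
    indE : ∀ {n} → Graph n → (Fin n → Bool) → Fin n → Fin n → Maybe (Fin k)
    indE G S u v = if S u then (if S v then E G u v else nothing) else nothing

    indIrr : ∀ {n} (G : Graph n) S u → indE G S u u ≡ nothing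
    indIrr G S u with S u
    ... | true  = irrefl G u
    ... | false = refl

    indSym : ∀ {n} (G : Graph n) S u v → indE G S v u ≡ Maybe.map flip (indE G S u v)
    indSym G S u v with S u | S v
    ... | true  | true  = E-sym G u v
    ... | true  | false = refl
    ... | false | true  = refl
    ... | false | false = refl

    indV : ∀ {n} (G : Graph n) S u v d → indE G S u v ≡ just d → V G u ∧ S u ≡ true
    indV G S u v d eq with S u | S v | E-V G u v d
    ... | true  | true  | h rewrite h eq = refl
    ... | true  | false | h with eq
    ...   | ()
    indV G S u v d eq | false | _ | h with eq
    ...   | ()

  induced : ∀ {n} → Graph n → (Fin n → Bool) → Graph n
  induced G S = record
    { V = λ u → V G u ∧ S u
    ; E = indE G S
    ; irrefl = indIrr G S
    ; E-sym = indSym G S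
    ; E-V = indV G S }

  IsK : ℕ → ∀ {n} → Graph n → Set
  IsK j G = (vertexCount G ≡ j)
          × (∀ u v → V G u ≡ true → V G v ≡ true → u ≢ v → Σ (Fin k) λ d → E G u v ≡ just d)

  data Reach {n} (G : Graph n) (S : Fin n → Bool) : Fin n → Fin n → Set where
    here : ∀ {u} → S u ≡ true → Reach G S u u
    step : ∀ {u v w} d → S u ≡ true → E G u v ≡ just d → Reach G S v w → Reach G S u w

  Connected : ∀ {n} → Graph n → (Fin n → Bool) → Set
  Connected G S = ∀ u v → S u ≡ true → S v ≡ true → Reach G S u v

  minus : ∀ {n} → (Fin n → Bool) → Fin n → (Fin n → Bool)
  minus S v x = S x ∧ not (does (x ≟ v))

  -- G[S] has no cut vertex (it is connected, so a cut vertex is one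
  -- whose removal disconnects)
  NoCutVertex : ∀ {n} → Graph n → (Fin n → Bool) → Set
  NoCutVertex G S = ∀ v → S v ≡ true → Connected G (minus S v)

  _⊆ₛ_ : ∀ {n} → (Fin n → Bool) → (Fin n → Bool) → Set
  S ⊆ₛ T = ∀ x → S x ≡ true → T x ≡ true

  -- S is the vertex set of a block: a maximal nonempty set inducing a
  -- connected subgraph without cut vertex (blocks are induced subgraphs)
  IsBlock : ∀ {n} → Graph n → (Fin n → Bool) → Set
  IsBlock G S = (S ⊆ₛ V G) × (∃ λ u → S u ≡ true) × Connected G S × NoCutVertex G S
              × (∀ T → S ⊆ₛ T → T ⊆ₛ V G → Connected G T → NoCutVertex G T → T ⊆ₛ S)

  Inclusive : Property → Set
  Inclusive Π = ∀ {n} (G : Graph n) → IsK 1 G ⊎ IsK 2 G → Π G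

  BlockAdditive : Property → Set
  BlockAdditive Π = ∀ {n} (G : Graph n) →
    (Π G → ∀ S → IsBlock G S → Π (induced G S))
    × ((∀ S → IsBlock G S → Π (induced G S)) → Π G)

  -- H = G - (E(U,W) ∖ F) for some F ⊆ E(U,W), where U = {side = true}
  record DeleteCross {n} (G : Graph n) (side : Fin n → Bool) (H : Graph n) : Set where
    field
      sameV    : ∀ u → V H u ≡ V G u
      sameIn   : ∀ u v → side u ≡ side v → E H u v ≡ E G u v
      crossSub : ∀ u v d → E H u v ≡ just d → E G u v ≡ just d

  StrongExt : ℝ → Property → Set
  StrongExt lam Π = ∀ {n} (G : Graph n) (side : Fin n → Bool) →
    Π (induced G side) → Π (induced G (λ x → not (side x))) →
    Σ (Graph n) λ H → DeleteCross G side H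
      × MulLe lam (crossCount G side) (crossCount H side) × Π H

  StronglyExtendible : ℝ → Property → Set
  StronglyExtendible lam Π = IsoClosed Π × Inclusive Π × BlockAdditive Π × StrongExt lam Π

  K3In : Property → Set
  K3In Π = ∀ {n} (G : Graph n) → IsK 3 G → Π G

  IsBeta : Property → ∀ {n} → Graph n → ℕ → Set
  IsBeta Π {n} G b = (Σ (Graph n) λ H → H ⊑ G × Π H × edgeCount H ≡ b)
                   × (∀ H → H ⊑ G → Π H → edgeCount H ℕ.≤ b)

  IsBetaK : Property → ℕ → ℕ → Set
  IsBetaK Π j b = (Σ ℕ λ n → Σ (Graph n) λ G → IsK j G × IsBeta Π G b)
                × (∀ {n} (G : Graph n) b' → IsK j G → IsBeta Π G b' → b ℕ.≤ b')

-- ex(K_j) > 0 given β(K_j) = b, i.e.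
--   λ·C(j,2) + (1-λ)(j-1)/2 < b.
-- The left side is a nondecreasing affine function of λ (slope (j-1)²/2),
-- so for a Dedekind real λ this means: some rational q > λ satisfies it.
exBound : ℕ → ℚ → ℚ
exBound j q = q ℚ.* ℕ→ℚ (j ℕ.* (j ℕ.∸ 1) ℕ./ 2) ℚ.+ (1ℚ ℚ.- q) ℚ.* (ℕ→ℚ (j ℕ.∸ 1) ℚ.* ½)

ExPositive : ℝ → ℕ → ℕ → Set
ExPositive lam j b = Σ ℚ λ q → U lam q × (exBound j q ℚ.< ℕ→ℚ b)

{-# OPTIONS --safe #-}
module Submission where

open import Data.Nat as ℕ using (ℕ; zero; suc; z≤n; s≤s)
import Data.Nat.Properties as ℕ
import Data.Nat.ListAction as List
open import Algebra.Properties.CommutativeMonoid.Sum ℕ.+-0-commutativeMonoid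
  using (sum-cong-≗; ∑-distrib-+) renaming (sum to ∑)
open import Data.Fin as Fin using (Fin; toℕ; _≟_)
import Data.Fin.Properties as Fin
open import Data.Bool using (Bool; true; false; _∧_; _∨_; not; _xor_; if_then_else_)
import Data.Bool.Properties as Bool
open import Data.Maybe as Maybe using (Maybe; just; nothing; is-just)
open import Data.List using (allFin; map; tabulate)
open import Data.List.Properties using (map-tabulate)
open import Data.Product using (Σ; _×_; _,_; proj₁; proj₂)
open import Data.Sum using (_⊎_; inj₁; inj₂; [_,_]′)
open import Data.Empty using (⊥-elim)
open import Function using (_∘_; id; case_of_; Equivalence)
open import Relation.Nullary using (does; no)
open import Relation.Nullary.Decidable using (dec-true; dec-false)
open import Relation.Binary.Definitions using (Tri; tri<; tri≈; tri>)
open import Relation.Binary.PropositionalEquality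
open import Defs

-- Induction on i in steps of two.  Let u, v be the two vertices of least index
-- of a graph G with U(G) = K_(i+2), and W the remaining K_i.  By induction G[W]
-- has a spanning Π-subgraph H_W with more than λ·C(i,2) + (1-λ)(i-1)/2 edges.
-- In the graph G′ obtained from G by replacing G[W] with H_W, both
-- G′[{u,v}] ≅ K_2 and G′[W] ≅ H_W lie in Π, so strong λ-extension gives a
-- Π-subgraph of G containing the edge uv, all of H_W and at least λ·2i of the
-- 2i edges between {u,v} and W.  The bound grows by exactly 1 + 2λi from i to
-- i + 2, which closes the induction.  The bases are K_2 ∈ Π and K_3: either
-- K_3 ∈ Π, or the extension step with i = 1 keeps an integral number c ≥ 2λ of
-- cross edges, and λ ≠ ½ forces c > 2λ.
-- Since λ is a Dedekind real, exceeding f(λ) (f nondecreasing) is witnessed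
-- by a rational q > λ; the induction step finds q by bracketing λ between
-- rationals p < λ < p + ε, using locatedness.

module ExBounds where
  open import Data.Nat.DivMod using (+-distrib-/-∣ʳ; m*n/n≡m)
  open import Data.Nat.Divisibility using (divides)
  import Data.Nat.Tactic.RingSolver as ℕ-Solver
  import Data.Nat.Coprimality as Coprime
  open import Data.Integer as ℤ using (+_; +≤+; +<+)
  import Data.Integer.Properties as ℤ
  open import Data.Rational as ℚ
    using (ℚ; mkℚ; 0ℚ; 1ℚ; ½; _+_; _*_; _-_; _≤_; _<_; _⊓_; 1/_; toℚᵘ; nonNegative; positive)
  open import Data.Rational.Properties as ℚ
  import Data.Rational.Unnormalised as ℚᵘ
  import Data.Rational.Unnormalised.Properties as ℚᵘ
  open import Data.Rational.Solver using (module +-*-Solver)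
  open +-*-Solver using (solve; _:=_; _:+_; _:*_; _:-_; con)

  ℕ→ℚ≡mkℚ : ∀ m → ℕ→ℚ m ≡ mkℚ (+ m) 0 (Coprime.sym (Coprime.1-coprimeTo m))
  ℕ→ℚ≡mkℚ m = normalize-coprime (Coprime.sym (Coprime.1-coprimeTo m))

  ℕ→ℚ-homo-+ : ∀ m n → ℕ→ℚ (m ℕ.+ n) ≡ ℕ→ℚ m + ℕ→ℚ n
  ℕ→ℚ-homo-+ m n rewrite ℕ→ℚ≡mkℚ m | ℕ→ℚ≡mkℚ n =
    /-cong (sym (cong₂ ℤ._+_ (ℤ.*-identityʳ (+ m)) (ℤ.*-identityʳ (+ n)))) refl

  ℕ→ℚ-mono-≤ : ∀ {m n} → m ℕ.≤ n → ℕ→ℚ m ≤ ℕ→ℚ n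
  ℕ→ℚ-mono-≤ {m} {n} m≤n rewrite ℕ→ℚ≡mkℚ m | ℕ→ℚ≡mkℚ n =
    ℚ.*≤* (subst₂ ℤ._≤_ (sym (ℤ.*-identityʳ (+ m))) (sym (ℤ.*-identityʳ (+ n))) (+≤+ m≤n))

  ℕ→ℚ-cancel-< : ∀ {m n} → ℕ→ℚ m < ℕ→ℚ n → m ℕ.< n
  ℕ→ℚ-cancel-< {m} {n} m<n rewrite ℕ→ℚ≡mkℚ m | ℕ→ℚ≡mkℚ n with m<n
  ... | ℚ.*<* m<n = ℤ.drop‿+<+ (subst₂ ℤ._<_ (ℤ.*-identityʳ (+ m)) (ℤ.*-identityʳ (+ n)) m<n)

  ℕ→ℚ-nonNeg : ∀ m → 0ℚ ≤ ℕ→ℚ m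
  ℕ→ℚ-nonNeg m = ℕ→ℚ-mono-≤ {0} {m} z≤n

  p≤q⇒0≤q-p : ∀ {p q} → p ≤ q → 0ℚ ≤ q - p
  p≤q⇒0≤q-p {p} {q} p≤q = subst (_≤ q - p) (+-inverseʳ p) (+-monoˡ-≤ (ℚ.- p) p≤q)

  p<q⇒0<q-p : ∀ {p q} → p < q → 0ℚ < q - p
  p<q⇒0<q-p {p} {q} p<q = subst (_< q - p) (+-inverseʳ p) (+-monoˡ-< (ℚ.- p) p<q)

  p<p+q : ∀ p {q} → 0ℚ < q → p < p + q
  p<p+q p {q} 0<q = subst (_< p + q) (+-identityʳ p) (+-monoʳ-< p 0<q)

  archimedean : ∀ g → 0ℚ < g → Σ ℕ λ t → 1ℚ ≤ ℕ→ℚ t * g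
  archimedean g@(mkℚ (+ suc m) d-1 _) _ =
    d , toℚᵘ-cancel-≤ (ℚᵘ.≤-respʳ-≃ (ℚᵘ.≃-sym (toℚᵘ-homo-* (ℕ→ℚ d) g)) 1≤d*g)
    where
    d : ℕ
    d = suc d-1
    1≤d*g : toℚᵘ 1ℚ ℚᵘ.≤ toℚᵘ (ℕ→ℚ d) ℚᵘ.* toℚᵘ g
    1≤d*g rewrite ℕ→ℚ≡mkℚ d = ℚᵘ.*≤* (+≤+ (subst₂ ℕ._≤_
      (sym (trans (ℕ.*-identityˡ (1 ℕ.* d)) (ℕ.*-identityˡ d))) (sym (ℕ.*-identityʳ (d ℕ.* suc m)))
      (ℕ.m≤m*n d (suc m))))
  archimedean (mkℚ (+ zero) _ _)     (ℚ.*<* (+<+ ()))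
  archimedean (mkℚ ℤ.-[1+ _ ] _ _) (ℚ.*<* ())

  small-multiple : ∀ K → 0ℚ ≤ K → ∀ δ → 0ℚ < δ → Σ ℚ λ ε → 0ℚ < ε × K * ε < δ
  small-multiple K 0≤K δ 0<δ = ε , 0<ε , (begin-strict
      K * ε               <⟨ p<p+q (K * ε) 0<ε ⟩
      K * ε + ε           ≡⟨ solve 3 (λ K δ w → K :* (δ :* w) :+ δ :* w := δ :* ((K :+ con 1ℚ) :* w)) refl K δ w ⟩
      δ * ((K + 1ℚ) * w)  ≡⟨ cong (δ *_) (*-inverseʳ (K + 1ℚ)) ⟩
      δ * 1ℚ              ≡⟨ *-identityʳ δ ⟩
      δ                   ∎)
    where
    open ≤-Reasoning
    instance
      K+1-pos : ℚ.Positive (K + 1ℚ)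
      K+1-pos = positive (≤-<-trans 0≤K (p<p+q K (ℚ.*<* (+<+ (s≤s z≤n)))))
      K+1-nonZero : ℚ.NonZero (K + 1ℚ)
      K+1-nonZero = pos⇒nonZero (K + 1ℚ)
    w ε : ℚ
    w = 1/ (K + 1ℚ)
    ε = δ * w
    0<ε : 0ℚ < ε
    0<ε = positive⁻¹ ε {{pos*pos⇒pos δ {{positive 0<δ}} w {{1/pos⇒pos (K + 1ℚ)}}}}

  pairs : ℕ → ℕ
  pairs j = j ℕ.* (j ℕ.∸ 1) ℕ./ 2

  pairs-suc-suc : ∀ j → pairs (suc (suc j)) ≡ pairs j ℕ.+ suc (2 ℕ.* j)
  pairs-suc-suc j = begin
      (suc (suc j) ℕ.* suc j) ℕ./ 2
    ≡⟨ cong (ℕ._/ 2) (double j) ⟩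
      (j ℕ.* (j ℕ.∸ 1) ℕ.+ suc (2 ℕ.* j) ℕ.* 2) ℕ./ 2
    ≡⟨ +-distrib-/-∣ʳ (j ℕ.* (j ℕ.∸ 1)) (divides (suc (2 ℕ.* j)) refl) ⟩
      pairs j ℕ.+ suc (2 ℕ.* j) ℕ.* 2 ℕ./ 2
    ≡⟨ cong (pairs j ℕ.+_) (m*n/n≡m (suc (2 ℕ.* j)) 2) ⟩
      pairs j ℕ.+ suc (2 ℕ.* j)
    ∎
    where
    open ≡-Reasoning
    expand : ∀ j → (3 ℕ.+ j) ℕ.* (2 ℕ.+ j) ≡ suc j ℕ.* j ℕ.+ suc (2 ℕ.* suc j) ℕ.* 2
    expand = ℕ-Solver.solve-∀
    double : ∀ j → suc (suc j) ℕ.* suc j ≡ j ℕ.* (j ℕ.∸ 1) ℕ.+ suc (2 ℕ.* j) ℕ.* 2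
    double zero    = refl
    double (suc j) = expand j

  ∸1≤pairs : ∀ j → j ℕ.∸ 1 ℕ.≤ pairs j
  ∸1≤pairs zero          = z≤n
  ∸1≤pairs (suc zero)    = z≤n
  ∸1≤pairs (suc (suc j)) = begin
    suc j                      ≤⟨ s≤s (ℕ.m≤n*m j 2) ⟩
    suc (2 ℕ.* j)              ≤⟨ ℕ.m≤n+m _ (pairs j) ⟩
    pairs j ℕ.+ suc (2 ℕ.* j)  ≡⟨ pairs-suc-suc j ⟨
    pairs (suc (suc j))        ∎
    where open ℕ.≤-Reasoning

  exBound-2 : ∀ q → exBound 2 q ≡ ½ + q * ½
  exBound-2 = solve 1 (λ q → q :* con 1ℚ :+ (con 1ℚ :- q) :* (con 1ℚ :* con ½) := con ½ :+ q :* con ½) refl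

  exBound-3 : ∀ q → exBound 3 q ≡ 1ℚ + ℕ→ℚ 2 * q
  exBound-3 = solve 1 (λ q → q :* con (ℕ→ℚ 3) :+ (con 1ℚ :- q) :* (con (ℕ→ℚ 2) :* con ½)
                          := con 1ℚ :+ con (ℕ→ℚ 2) :* q) refl

  exBound-suc-suc : ∀ j q → exBound (3 ℕ.+ j) q ≡ exBound (suc j) q + 1ℚ + ℕ→ℚ (2 ℕ.* suc j) * q
  exBound-suc-suc j q = begin
      exBound (3 ℕ.+ j) q
    ≡⟨ cong₂ (λ P B → q * P + (1ℚ - q) * (B * ½)) pairs≡ (ℕ→ℚ-homo-+ 2 j) ⟩
      q * (P + (1ℚ + K)) + (1ℚ - q) * ((ℕ→ℚ 2 + N) * ½)
    ≡⟨ solve 4 (λ q P N K → q :* (P :+ (con 1ℚ :+ K)) :+ (con 1ℚ :- q) :* ((con (ℕ→ℚ 2) :+ N) :* con ½)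
                          := q :* P :+ (con 1ℚ :- q) :* (N :* con ½) :+ con 1ℚ :+ K :* q) refl q P N K ⟩
      exBound (suc j) q + 1ℚ + K * q
    ∎
    where
    open ≡-Reasoning
    P N K : ℚ
    P = ℕ→ℚ (pairs (suc j))
    N = ℕ→ℚ j
    K = ℕ→ℚ (2 ℕ.* suc j)
    pairs≡ : ℕ→ℚ (pairs (3 ℕ.+ j)) ≡ P + (1ℚ + K)
    pairs≡ = trans (cong ℕ→ℚ (pairs-suc-suc (suc j)))
                   (trans (ℕ→ℚ-homo-+ (pairs (suc j)) _) (cong (_+_ P) (ℕ→ℚ-homo-+ 1 (2 ℕ.* suc j))))

  exBound-affine : ∀ j q → exBound j q ≡ ℕ→ℚ (j ℕ.∸ 1) * ½ + q * (ℕ→ℚ (pairs j) - ℕ→ℚ (j ℕ.∸ 1) * ½)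
  exBound-affine j q =
    solve 3 (λ q P B → q :* P :+ (con 1ℚ :- q) :* (B :* con ½) := B :* con ½ :+ q :* (P :- B :* con ½))
      refl q (ℕ→ℚ (pairs j)) (ℕ→ℚ (j ℕ.∸ 1))

  exBound-mono-≤ : ∀ j {r q} → r ≤ q → exBound j r ≤ exBound j q
  exBound-mono-≤ j {r} {q} r≤q = begin
    exBound j r              ≡⟨ exBound-affine j r ⟩
    B * ½ + r * (P - B * ½)  ≤⟨ +-monoʳ-≤ (B * ½) (*-monoʳ-≤-nonNeg (P - B * ½) {{nonNegative (p≤q⇒0≤q-p B½≤P)}} r≤q) ⟩
    B * ½ + q * (P - B * ½)  ≡⟨ exBound-affine j q ⟨
    exBound j q              ∎
    where
    open ≤-Reasoning
    P B : ℚ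
    P = ℕ→ℚ (pairs j)
    B = ℕ→ℚ (j ℕ.∸ 1)
    B½≤P : B * ½ ≤ P
    B½≤P = begin
      B * ½   ≤⟨ *-monoˡ-≤-nonNeg B {{nonNegative (ℕ→ℚ-nonNeg (j ℕ.∸ 1))}} (ℚ.*≤* (+≤+ (s≤s z≤n))) ⟩
      B * 1ℚ  ≡⟨ *-identityʳ B ⟩
      B       ≤⟨ ℕ→ℚ-mono-≤ (∸1≤pairs j) ⟩
      P       ∎

  U-⊓ : ∀ x {a b} → U x a → U x b → U x (a ⊓ b)
  U-⊓ x {a} {b} Ua Ub = [ (λ eq → subst (U x) (sym eq) Ua) , (λ eq → subst (U x) (sym eq) Ub) ]′ (⊓-sel a b)

  MulLe-antitone : ∀ x {m m′ k} → m′ ℕ.≤ m → MulLe x m k → MulLe x m′ k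
  MulLe-antitone x {m} {m′} {k} m′≤m xm≤k q Lq with ≤-total q 0ℚ
  ... | inj₁ q≤0 = begin
    q * ℕ→ℚ m′   ≤⟨ *-monoʳ-≤-nonNeg (ℕ→ℚ m′) {{nonNegative (ℕ→ℚ-nonNeg m′)}} q≤0 ⟩
    0ℚ * ℕ→ℚ m′  ≡⟨ *-zeroˡ (ℕ→ℚ m′) ⟩
    0ℚ           ≤⟨ ℕ→ℚ-nonNeg k ⟩
    ℕ→ℚ k        ∎
    where open ≤-Reasoning
  ... | inj₂ 0≤q = ≤-trans (*-monoˡ-≤-nonNeg q {{nonNegative 0≤q}} (ℕ→ℚ-mono-≤ m′≤m)) (xm≤k q Lq)

  MulLe⇒< : ∀ x {m k n p} → MulLe x m k → L x p → ℕ→ℚ n < p * ℕ→ℚ m → n ℕ.< k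
  MulLe⇒< x {m} {k} {n} {p} xm≤k Lp n<pm = ℕ→ℚ-cancel-< (<-≤-trans n<pm (xm≤k p Lp))

  ExPositive-mono : ∀ x j {c c′} → c ℕ.≤ c′ → ExPositive x j c → ExPositive x j c′
  ExPositive-mono x j c≤c′ (q , Uq , ex<c) = q , Uq , <-≤-trans ex<c (ℕ→ℚ-mono-≤ c≤c′)

  module _ (lam : ℝ) (0<lam<1 : InOpenUnit lam) where

    private
      L0 : L lam 0ℚ
      L0 = proj₁ 0<lam<1

      U1 : U lam 1ℚ
      U1 = proj₂ 0<lam<1

    L⇒<1 : ∀ {a} → L lam a → a < 1ℚ
    L⇒<1 {a} La with <-cmp a 1ℚ
    ... | tri< a<1 _ _  = a<1
    ... | tri≈ _ refl _ = ⊥-elim (disjoint lam 1ℚ La U1)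
    ... | tri> _ _ 1<a  = ⊥-elim (disjoint lam 1ℚ (L-down lam 1ℚ a 1<a La) U1)

    -- Walk up from 0 in steps of ε/2, asking locatedness whether λ < a + ε;
    -- as λ < 1, the walk stops within the Archimedean number of steps.
    bracket : ∀ ε → 0ℚ < ε → Σ ℚ λ p → L lam p × U lam (p + ε)
    bracket ε 0<ε =
      let t , 1≤tg = archimedean g 0<g in scan t 0ℚ L0 (subst (1ℚ ≤_) (sym (+-identityˡ _)) 1≤tg)
      where
      g : ℚ
      g = ε * ½
      0<g : 0ℚ < g
      0<g = positive⁻¹ g {{pos*pos⇒pos ε {{positive 0<ε}} ½}}
      g<ε : g < ε
      g<ε = <-≤-trans (*-monoʳ-<-pos ε {{positive 0<ε}} (ℚ.*<* (+<+ (s≤s (s≤s z≤n))))) (≤-reflexive (*-identityʳ ε))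
      scan : ∀ t a → L lam a → 1ℚ ≤ a + ℕ→ℚ t * g → Σ ℚ λ p → L lam p × U lam (p + ε)
      scan zero a La 1≤a+0 =
        ⊥-elim (<-irrefl refl (<-≤-trans (L⇒<1 La) (subst (1ℚ ≤_) (solve 2 (λ a g → a :+ con 0ℚ :* g := a) refl a g) 1≤a+0)))
      scan (suc t) a La 1≤a+tg with located lam (a + g) (a + ε) (+-monoʳ-< a g<ε)
      ... | inj₁ L[a+g] = scan t (a + g) L[a+g] (subst (1ℚ ≤_) shift 1≤a+tg)
        where
        shift : a + ℕ→ℚ (suc t) * g ≡ a + g + ℕ→ℚ t * g
        shift = trans (cong (λ s → a + s * g) (ℕ→ℚ-homo-+ 1 t))
                      (solve 3 (λ a g T → a :+ (con 1ℚ :+ T) :* g := a :+ g :+ T :* g) refl a g (ℕ→ℚ t))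
      ... | inj₂ U[a+ε] = a , La , U[a+ε]

    ExPositive-2 : ExPositive lam 2 1
    ExPositive-2 = let q , q<1 , Uq = U-rounded lam 1ℚ U1 in q , Uq , (begin-strict
      exBound 2 q  ≡⟨ exBound-2 q ⟩
      ½ + q * ½    <⟨ +-monoʳ-< ½ (*-monoˡ-<-pos ½ q<1) ⟩
      ½ + 1ℚ * ½   ≡⟨⟩
      1ℚ           ∎)
      where open ≤-Reasoning

    ExPositive-3 : ExPositive lam 3 3
    ExPositive-3 = let q , q<1 , Uq = U-rounded lam 1ℚ U1 in q , Uq , (begin-strict
      exBound 3 q      ≡⟨ exBound-3 q ⟩
      1ℚ + ℕ→ℚ 2 * q   <⟨ +-monoʳ-< 1ℚ (*-monoʳ-<-pos (ℕ→ℚ 2) q<1) ⟩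
      1ℚ + ℕ→ℚ 2 * 1ℚ  ≡⟨⟩
      ℕ→ℚ 3            ∎)
      where open ≤-Reasoning

    ExPositive-3-apart : ∀ {c} → Apart½ lam → MulLe lam 2 c → ExPositive lam 3 (suc c)
    ExPositive-3-apart {c} (inj₁ ½<lam) lam2≤c =
      let r , ½<r , Lr = L-rounded lam ½ ½<lam
          1<c = MulLe⇒< lam {2} {c} {1} lam2≤c Lr (*-monoˡ-<-pos (ℕ→ℚ 2) ½<r)
      in ExPositive-mono lam 3 (s≤s 1<c) ExPositive-3
    ExPositive-3-apart {c} (inj₂ lam<½) lam2≤c =
      let q , q<½ , Uq = U-rounded lam ½ lam<½
          r , 0<r , Lr = L-rounded lam 0ℚ L0
          0<c = MulLe⇒< lam {2} {c} {0} lam2≤c Lr (*-monoˡ-<-pos (ℕ→ℚ 2) 0<r)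
      in q , Uq , (begin-strict
        exBound 3 q     ≡⟨ exBound-3 q ⟩
        1ℚ + ℕ→ℚ 2 * q  <⟨ +-monoʳ-< 1ℚ (*-monoʳ-<-pos (ℕ→ℚ 2) q<½) ⟩
        1ℚ + ℕ→ℚ 2 * ½  ≡⟨⟩
        ℕ→ℚ 2           ≤⟨ ℕ→ℚ-mono-≤ (s≤s 0<c) ⟩
        ℕ→ℚ (suc c)     ∎)
      where open ≤-Reasoning

    -- The witness is min(q₁, p + ε), where p < λ < p + ε and 2(j+1)·ε is
    -- below the slack c - exBound (j+1) q₁ of the hypothesis.
    ExPositive-suc-suc : ∀ j {c x} → ExPositive lam (suc j) c → MulLe lam (2 ℕ.* suc j) x →
                         ExPositive lam (3 ℕ.+ j) (suc (c ℕ.+ x))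
    ExPositive-suc-suc j {c} {x} (q₁ , Uq₁ , e₁<C) lamK≤x =
      let ε , 0<ε , Kε<δ = small-multiple K (ℕ→ℚ-nonNeg (2 ℕ.* suc j)) δ (p<q⇒0<q-p e₁<C)
          p , Lp , U[p+ε] = bracket ε 0<ε
          q = q₁ ⊓ (p + ε)
      in q , U-⊓ lam Uq₁ U[p+ε] , (begin-strict
        exBound (3 ℕ.+ j) q
          ≡⟨ exBound-suc-suc j q ⟩
        exBound (suc j) q + 1ℚ + K * q
          ≤⟨ +-mono-≤ (+-monoˡ-≤ 1ℚ (exBound-mono-≤ (suc j) (p⊓q≤p q₁ (p + ε))))
                      (*-monoˡ-≤-nonNeg K {{nonNegative (ℕ→ℚ-nonNeg (2 ℕ.* suc j))}} (p⊓q≤q q₁ (p + ε))) ⟩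
        e₁ + 1ℚ + K * (p + ε)
          ≡⟨ cong (_+_ (e₁ + 1ℚ)) (solve 3 (λ K p ε → K :* (p :+ ε) := p :* K :+ K :* ε) refl K p ε) ⟩
        e₁ + 1ℚ + (p * K + K * ε)
          <⟨ +-monoʳ-< (e₁ + 1ℚ) (+-mono-≤-< (lamK≤x p Lp) Kε<δ) ⟩
        e₁ + 1ℚ + (X + δ)
          ≡⟨ solve 3 (λ E C X → E :+ con 1ℚ :+ (X :+ (C :- E)) := con 1ℚ :+ (C :+ X)) refl e₁ C X ⟩
        1ℚ + (C + X)
          ≡⟨ trans (ℕ→ℚ-homo-+ 1 (c ℕ.+ x)) (cong (_+_ 1ℚ) (ℕ→ℚ-homo-+ c x)) ⟨
        ℕ→ℚ (suc (c ℕ.+ x))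
          ∎)
      where
      open ≤-Reasoning
      K e₁ C X δ : ℚ
      K = ℕ→ℚ (2 ℕ.* suc j)
      e₁ = exBound (suc j) q₁
      C = ℕ→ℚ c
      X = ℕ→ℚ x
      δ = C - e₁

open ExBounds

open import Data.Nat using (_+_; _≤_; _<_; _<ᵇ_)

∧≡true⇒ : ∀ {a b} → a ∧ b ≡ true → a ≡ true × b ≡ true
∧≡true⇒ {true} {true} _ = refl , refl

∧≡true⇐ : ∀ {a b} → a ≡ true → b ≡ true → a ∧ b ≡ true
∧≡true⇐ refl refl = refl

<⇒<ᵇ≡true : ∀ {m n} → m < n → (m <ᵇ n) ≡ true
<⇒<ᵇ≡true m<n = Equivalence.to Bool.T-≡ (ℕ.<⇒<ᵇ m<n)

¬just⇒nothing : ∀ {A : Set} {e : Maybe A} → (∀ a → e ≢ just a) → e ≡ nothing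
¬just⇒nothing {e = nothing} _      = refl
¬just⇒nothing {e = just a}  e≢just = ⊥-elim (e≢just a refl)

sum-tabulate : ∀ {n} (f : Fin n → ℕ) → List.sum (tabulate f) ≡ ∑ f
sum-tabulate {zero}  f = refl
sum-tabulate {suc n} f = cong (f Fin.zero +_) (sum-tabulate (f ∘ Fin.suc))

sum-map-allFin : ∀ n (f : Fin n → ℕ) → List.sum (map f (allFin n)) ≡ ∑ f
sum-map-allFin n f = trans (cong List.sum (map-tabulate id f)) (sum-tabulate f)

sum-map-allFin² : ∀ n (f : Fin n → Fin n → ℕ) →
                  List.sum (map (λ x → List.sum (map (f x) (allFin n))) (allFin n)) ≡ ∑ λ x → ∑ (f x)
sum-map-allFin² n f = trans (sum-map-allFin n _) (sum-cong-≗ (λ x → sum-map-allFin n (f x)))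

∑-mono-≤ : ∀ {n} {f g : Fin n → ℕ} → (∀ x → f x ≤ g x) → ∑ f ≤ ∑ g
∑-mono-≤ {zero}  f≤g = z≤n
∑-mono-≤ {suc n} f≤g = ℕ.+-mono-≤ (f≤g Fin.zero) (∑-mono-≤ (f≤g ∘ Fin.suc))

≤-∑ : ∀ {n} (f : Fin n → ℕ) a → f a ≤ ∑ f
≤-∑ f Fin.zero    = ℕ.m≤m+n _ _
≤-∑ f (Fin.suc a) = ℕ.≤-trans (≤-∑ (f ∘ Fin.suc) a) (ℕ.m≤n+m _ (f Fin.zero))

+-≤-∑ : ∀ {n} (f : Fin n → ℕ) {a b} → a ≢ b → f a + f b ≤ ∑ f
+-≤-∑ f {Fin.zero}  {Fin.zero}  a≢b = ⊥-elim (a≢b refl)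
+-≤-∑ f {Fin.zero}  {Fin.suc b} a≢b = ℕ.+-monoʳ-≤ (f Fin.zero) (≤-∑ (f ∘ Fin.suc) b)
+-≤-∑ f {Fin.suc a} {Fin.zero}  a≢b =
  subst (_≤ ∑ f) (ℕ.+-comm (f Fin.zero) (f (Fin.suc a))) (ℕ.+-monoʳ-≤ (f Fin.zero) (≤-∑ (f ∘ Fin.suc) a))
+-≤-∑ f {Fin.suc a} {Fin.suc b} a≢b =
  ℕ.≤-trans (+-≤-∑ (f ∘ Fin.suc) (a≢b ∘ cong Fin.suc)) (ℕ.m≤n+m _ (f Fin.zero))

≤-∑² : ∀ {n} (f : Fin n → Fin n → ℕ) a b → f a b ≤ ∑ λ x → ∑ (f x)
≤-∑² f a b = ℕ.≤-trans (≤-∑ (f a) b) (≤-∑ (λ x → ∑ (f x)) a)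

∑²-distrib-+ : ∀ {n} (f g : Fin n → Fin n → ℕ) →
               (∑ λ x → ∑ λ y → f x y + g x y) ≡ (∑ λ x → ∑ (f x)) + (∑ λ x → ∑ (g x))
∑²-distrib-+ f g = trans (sum-cong-≗ (λ x → ∑-distrib-+ (f x) (g x))) (∑-distrib-+ (λ x → ∑ (f x)) (λ x → ∑ (g x)))

indicator : Bool → ℕ
indicator b = if b then 1 else 0

1≤indicator : ∀ {b} → b ≡ true → 1 ≤ indicator b
1≤indicator refl = s≤s z≤n

indicator≤ : ∀ b {m} → (b ≡ true → 1 ≤ m) → indicator b ≤ m
indicator≤ true  1≤m = 1≤m refl
indicator≤ false _   = z≤n

count : ∀ {n} → (Fin n → Bool) → ℕ
count P = ∑ (indicator ∘ P)

count-cong : ∀ {n} {P Q : Fin n → Bool} → (∀ x → P x ≡ Q x) → count P ≡ count Q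
count-cong P≗Q = sum-cong-≗ (cong indicator ∘ P≗Q)

count-split : ∀ {n} (P Q : Fin n → Bool) → count P ≡ count (λ x → P x ∧ Q x) + count (λ x → P x ∧ not (Q x))
count-split P Q =
  trans (sum-cong-≗ pointwise) (∑-distrib-+ (λ x → indicator (P x ∧ Q x)) (λ x → indicator (P x ∧ not (Q x))))
  where
  pointwise : ∀ x → indicator (P x) ≡ indicator (P x ∧ Q x) + indicator (P x ∧ not (Q x))
  pointwise x with P x | Q x
  ... | true  | true  = refl
  ... | true  | false = refl
  ... | false | _     = refl

without : ∀ {n} → Fin n → (Fin n → Bool) → Fin n → Bool
without a P x = P x ∧ not (does (x ≟ a))

without⇒≢ : ∀ {n} {a x : Fin n} (P : Fin n → Bool) → without a P x ≡ true → x ≢ a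
without⇒≢ {a = a} P x∈P∖a refl rewrite dec-true (a ≟ a) refl | Bool.∧-zeroʳ (P a) = case x∈P∖a of λ ()

≢⇒without : ∀ {n} {a x : Fin n} (P : Fin n → Bool) → P x ≡ true → x ≢ a → without a P x ≡ true
≢⇒without {a = a} {x} P Px x≢a rewrite Px | dec-false (x ≟ a) x≢a = refl

count-without : ∀ {n} (P : Fin n → Bool) a → P a ≡ true → count P ≡ suc (count (without a P))
count-without {suc n} P Fin.zero Pa rewrite Pa =
  cong suc (count-cong {n} λ x → sym (Bool.∧-identityʳ (P (Fin.suc x))))
count-without {suc n} P (Fin.suc a) Pa
  rewrite count-without (P ∘ Fin.suc) a Pa | Bool.∧-identityʳ (P Fin.zero) = ℕ.+-suc _ _

count-without-suc : ∀ {n m} (P : Fin n → Bool) {a} → P a ≡ true → count P ≡ suc m → count (without a P) ≡ m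
count-without-suc P {a} Pa #P≡1+m = ℕ.suc-injective (trans (sym (count-without P a Pa)) #P≡1+m)

least : ∀ {n} (P : Fin n → Bool) → 0 < count P →
        Σ (Fin n) λ u → P u ≡ true × (∀ y → P y ≡ true → toℕ u ≤ toℕ y)
least {suc n} P 0<#P with P Fin.zero in P0
... | true  = Fin.zero , P0 , λ _ _ → z≤n
... | false with least (P ∘ Fin.suc) 0<#P
...   | u , Pu , u-least = Fin.suc u , Pu , λ
  { Fin.zero    Py → case trans (sym P0) Py of λ ()
  ; (Fin.suc y) Py → s≤s (u-least y Py) }

pair : ∀ {n} → Fin n → Fin n → Fin n → Bool
pair u v x = does (x ≟ u) ∨ does (x ≟ v)

pair-left : ∀ {n} (u v : Fin n) → pair u v u ≡ true
pair-left u v rewrite dec-true (u ≟ u) refl = refl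

pair-right : ∀ {n} (u v : Fin n) → pair u v v ≡ true
pair-right u v rewrite dec-true (v ≟ v) refl = Bool.∨-zeroʳ (does (v ≟ u))

not-pair⇒≢ : ∀ {n} {u v y : Fin n} → not (pair u v y) ≡ true → y ≢ u × y ≢ v
not-pair⇒≢ {u = u} {v} {y} y∉uv with y ≟ u | y ≟ v
... | no y≢u | no y≢v = y≢u , y≢v

-- crossCount counts each pair from the row of its smaller index; taking u and
-- v of least index puts every edge between {u, v} and the rest into their rows.
record TwoLeast {n} (P : Fin n → Bool) (i : ℕ) : Set where
  field
    u v        : Fin n
    P-u        : P u ≡ true
    P-v        : P v ≡ true
    u≢v        : u ≢ v
    pair-count : count (λ x → P x ∧ pair u v x) ≡ 2
    rest-count : count (λ x → P x ∧ not (pair u v x)) ≡ i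
    precede    : ∀ y → P y ∧ not (pair u v y) ≡ true → toℕ u < toℕ y × toℕ v < toℕ y

twoLeast : ∀ {n} (P : Fin n → Bool) i → count P ≡ 2 + i → TwoLeast P i
twoLeast P i #P≡2+i with least P (subst (0 <_) (sym #P≡2+i) (s≤s z≤n))
... | u , Pu , u-least with least (without u P) (subst (0 <_) (sym (count-without-suc P Pu #P≡2+i)) (s≤s z≤n))
...   | v , P∖u-v , v-least = record
  { u = u ; v = v ; P-u = Pu ; P-v = proj₁ (∧≡true⇒ P∖u-v) ; u≢v = ≢-sym (without⇒≢ P P∖u-v)
  ; pair-count = ℕ.+-cancelʳ-≡ i _ 2 (trans (cong (_ +_) (sym #rest≡i)) (trans (sym (count-split P (pair u v))) #P≡2+i))
  ; rest-count = #rest≡i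
  ; precede    = precede }
  where
  rest≗ : ∀ x → P x ∧ not (pair u v x) ≡ without v (without u P) x
  rest≗ x with P x | does (x ≟ u) | does (x ≟ v)
  ... | false | _     | _     = refl
  ... | true  | true  | _     = refl
  ... | true  | false | true  = refl
  ... | true  | false | false = refl
  #rest≡i : count (λ x → P x ∧ not (pair u v x)) ≡ i
  #rest≡i = trans (count-cong rest≗) (count-without-suc (without u P) P∖u-v (count-without-suc P Pu #P≡2+i))
  precede : ∀ y → P y ∧ not (pair u v y) ≡ true → toℕ u < toℕ y × toℕ v < toℕ y
  precede y Py∧y∉uv =
    let Py , y∉uv = ∧≡true⇒ Py∧y∉uv
        y≢u , y≢v = not-pair⇒≢ y∉uv
    in Fin.≤∧≢⇒< (u-least y Py) (≢-sym y≢u) , Fin.≤∧≢⇒< (v-least y (≢⇒without P Py y≢u)) (≢-sym y≢v)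

module _ {k : ℕ} {flip : Fin k → Fin k} where

  Adjacent : ∀ {n} → Graph flip n → Fin n → Fin n → Set
  Adjacent G x y = Σ (Fin k) λ d → E G x y ≡ just d

  Complete : ∀ {n} → Graph flip n → Set
  Complete G = ∀ x y → V G x ≡ true → V G y ≡ true → x ≢ y → Adjacent G x y

  E-V₂ : ∀ {n} (G : Graph flip n) x y d → E G x y ≡ just d → V G y ≡ true
  E-V₂ G x y d Exy = E-V G y x (flip d) (trans (E-sym G x y) (cong (Maybe.map flip) Exy))

  edgeTerm : ∀ {n} → Graph flip n → Fin n → Fin n → ℕ
  edgeTerm G x y = indicator ((toℕ x <ᵇ toℕ y) ∧ is-just (E G x y))

  crossTerm : ∀ {n} → Graph flip n → (Fin n → Bool) → Fin n → Fin n → ℕ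
  crossTerm G S x y = indicator ((toℕ x <ᵇ toℕ y) ∧ (S x xor S y) ∧ is-just (E G x y))

  vertexCount≡count : ∀ {n} (G : Graph flip n) → vertexCount flip G ≡ count (V G)
  vertexCount≡count {n} G = sum-map-allFin n (indicator ∘ V G)

  edgeCount≡∑ : ∀ {n} (G : Graph flip n) → edgeCount flip G ≡ ∑ λ x → ∑ (edgeTerm G x)
  edgeCount≡∑ {n} G = sum-map-allFin² n (edgeTerm G)

  crossCount≡∑ : ∀ {n} (G : Graph flip n) S → crossCount flip G S ≡ ∑ λ x → ∑ (crossTerm G S x)
  crossCount≡∑ {n} G S = sum-map-allFin² n (crossTerm G S)

  edgeCount-cong : ∀ {n} {G H : Graph flip n} → (∀ x y → E G x y ≡ E H x y) → edgeCount flip G ≡ edgeCount flip H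
  edgeCount-cong {G = G} {H} E≗ = begin
    edgeCount flip G            ≡⟨ edgeCount≡∑ G ⟩
    ∑ (λ x → ∑ (edgeTerm G x))  ≡⟨ sum-cong-≗ (λ x → sum-cong-≗ λ y → cong (λ e → indicator (_ ∧ is-just e)) (E≗ x y)) ⟩
    ∑ (λ x → ∑ (edgeTerm H x))  ≡⟨ edgeCount≡∑ H ⟨
    edgeCount flip H            ∎
    where open ≡-Reasoning

  1≤edgeTerm : ∀ {n} (G : Graph flip n) {x y} → toℕ x < toℕ y → Adjacent G x y → 1 ≤ edgeTerm G x y
  1≤edgeTerm G x<y (d , Exy) = 1≤indicator (∧≡true⇐ (<⇒<ᵇ≡true x<y) (cong is-just Exy))

  Adjacent⇒1≤edgeCount : ∀ {n} (G : Graph flip n) {u v} → u ≢ v → Adjacent G u v → 1 ≤ edgeCount flip G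
  Adjacent⇒1≤edgeCount G {u} {v} u≢v (d , Euv) = subst (1 ≤_) (sym (edgeCount≡∑ G)) (1≤∑² (Fin.<-cmp u v))
    where
    1≤∑² : Tri (u Fin.< v) (u ≡ v) (v Fin.< u) → 1 ≤ ∑ λ x → ∑ (edgeTerm G x)
    1≤∑² (tri< u<v _ _) = ℕ.≤-trans (1≤edgeTerm G u<v (d , Euv)) (≤-∑² (edgeTerm G) u v)
    1≤∑² (tri≈ _ u≡v _) = ⊥-elim (u≢v u≡v)
    1≤∑² (tri> _ _ v<u) =
      ℕ.≤-trans (1≤edgeTerm G v<u (flip d , trans (E-sym G u v) (cong (Maybe.map flip) Euv))) (≤-∑² (edgeTerm G) v u)

  edgeCount-split : ∀ {n} (G : Graph flip n) S →
    edgeCount flip G ≡ edgeCount flip (induced flip G S) + edgeCount flip (induced flip G (λ x → not (S x)))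
                       + crossCount flip G S
  edgeCount-split {n} G S = begin
      edgeCount flip G
    ≡⟨ edgeCount≡∑ G ⟩
      ∑ (λ x → ∑ (edgeTerm G x))
    ≡⟨ sum-cong-≗ (λ x → sum-cong-≗ λ y → split (toℕ x <ᵇ toℕ y) (S x) (S y) (E G x y)) ⟩
      ∑ (λ x → ∑ λ y → edgeTerm G[S] x y + edgeTerm G[¬S] x y + crossTerm G S x y)
    ≡⟨ ∑²-distrib-+ (λ x y → edgeTerm G[S] x y + edgeTerm G[¬S] x y) (crossTerm G S) ⟩
      ∑ (λ x → ∑ λ y → edgeTerm G[S] x y + edgeTerm G[¬S] x y) + ∑ (λ x → ∑ (crossTerm G S x))
    ≡⟨ cong (_+ ∑ (λ x → ∑ (crossTerm G S x))) (∑²-distrib-+ (edgeTerm G[S]) (edgeTerm G[¬S])) ⟩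
      ∑ (λ x → ∑ (edgeTerm G[S] x)) + ∑ (λ x → ∑ (edgeTerm G[¬S] x)) + ∑ (λ x → ∑ (crossTerm G S x))
    ≡⟨ cong₂ _+_ (cong₂ _+_ (edgeCount≡∑ G[S]) (edgeCount≡∑ G[¬S])) (crossCount≡∑ G S) ⟨
      edgeCount flip G[S] + edgeCount flip G[¬S] + crossCount flip G S
    ∎
    where
    open ≡-Reasoning
    G[S] G[¬S] : Graph flip n
    G[S] = induced flip G S
    G[¬S] = induced flip G (λ x → not (S x))
    split : ∀ b s t (e : Maybe (Fin k)) →
      indicator (b ∧ is-just e) ≡
        indicator (b ∧ is-just (if s then (if t then e else nothing) else nothing))
      + indicator (b ∧ is-just (if not s then (if not t then e else nothing) else nothing))
      + indicator (b ∧ (s xor t) ∧ is-just e)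
    split false _     _     _        = refl
    split true  true  true  nothing  = refl
    split true  true  true  (just _) = refl
    split true  true  false nothing  = refl
    split true  true  false (just _) = refl
    split true  false true  nothing  = refl
    split true  false true  (just _) = refl
    split true  false false nothing  = refl
    split true  false false (just _) = refl

  induced-E : ∀ {n} (G : Graph flip n) S {x y} → S x ≡ true → S y ≡ true → E (induced flip G S) x y ≡ E G x y
  induced-E G S Sx Sy rewrite Sx | Sy = refl

  induced-E⊆ : ∀ {n} (G : Graph flip n) S {x y d} → E (induced flip G S) x y ≡ just d → E G x y ≡ just d
  induced-E⊆ G S {x} {y} Exy with S x | S y
  ... | true  | true  = Exy
  ... | true  | false = case Exy of λ ()
  ... | false | _     = case Exy of λ ()

  induced-≗ : ∀ {n} (H K : Graph flip n) W → (∀ x → V K x ≡ true → W x ≡ true) →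
              (∀ x y → W x ≡ true → W y ≡ true → E H x y ≡ E K x y) →
              ∀ x y → E (induced flip H W) x y ≡ E K x y
  induced-≗ H K W K⊆W agree x y with W x in Wx | W y in Wy
  ... | true  | true  = agree x y Wx Wy
  ... | true  | false = sym (¬just⇒nothing λ d Exy → case trans (sym Wy) (K⊆W y (E-V₂ K x y d Exy)) of λ ())
  ... | false | _     = sym (¬just⇒nothing λ d Exy → case trans (sym Wx) (K⊆W x (E-V K x y d Exy)) of λ ())

  induced-complete : ∀ {n} (G : Graph flip n) S → Complete G → Complete (induced flip G S)
  induced-complete G S complete x y x∈ y∈ x≢y =
    let Gx , Sx = ∧≡true⇒ x∈
        Gy , Sy = ∧≡true⇒ y∈
        d , Exy = complete x y Gx Gy x≢y
    in d , trans (induced-E G S Sx Sy) Exy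

  edgeCount-split-≥ : ∀ {n} (H : Graph flip n) S {u v} → S u ≡ true → S v ≡ true → u ≢ v → Adjacent H u v →
    suc (edgeCount flip (induced flip H (λ x → not (S x))) + crossCount flip H S) ≤ edgeCount flip H
  edgeCount-split-≥ {n} H S Su Sv u≢v (d , Euv) = begin
    suc (edgeCount flip H[¬S] + crossCount flip H S)                  ≤⟨ ℕ.+-monoˡ-≤ _ (ℕ.+-monoˡ-≤ _ 1≤#H[S]) ⟩
    edgeCount flip H[S] + edgeCount flip H[¬S] + crossCount flip H S  ≡⟨ edgeCount-split H S ⟨
    edgeCount flip H                                                  ∎
    where
    open ℕ.≤-Reasoning
    H[S] H[¬S] : Graph flip n
    H[S] = induced flip H S
    H[¬S] = induced flip H (λ x → not (S x))
    1≤#H[S] : 1 ≤ edgeCount flip H[S]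
    1≤#H[S] = Adjacent⇒1≤edgeCount H[S] u≢v (d , trans (induced-E H S Su Sv) Euv)

  count≤crossRow : ∀ {n} (G : Graph flip n) S (P : Fin n → Bool) {w} → S w ≡ true →
    (∀ y → P y ≡ true → S y ≡ false × toℕ w < toℕ y × Adjacent G w y) → count P ≤ ∑ (crossTerm G S w)
  count≤crossRow G S P Sw row = ∑-mono-≤ λ y → indicator≤ (P y) λ Py →
    let Sy , w<y , d , Ewy = row y Py
    in 1≤indicator (∧≡true⇐ (<⇒<ᵇ≡true w<y) (∧≡true⇐ (cong₂ _xor_ Sw Sy) (cong is-just Ewy)))

  Iso-≗ : ∀ {n} {G H : Graph flip n} → (∀ x → V G x ≡ V H x) →
          (∀ x y → V G x ≡ true → V G y ≡ true → E H x y ≡ E G x y) → Iso flip G H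
  Iso-≗ V≗ E≗ = record
    { f = id ; g = id
    ; f-V = λ x Gx → trans (sym (V≗ x)) Gx
    ; g-V = λ x Hx → trans (V≗ x) Hx
    ; gf = λ _ _ → refl ; fg = λ _ _ → refl
    ; f-E = E≗ }

  record Spanning {n} (G H : Graph flip n) : Set where
    field
      V≡ : ∀ x → V H x ≡ V G x
      E⊆ : ∀ x y d → E H x y ≡ just d → E G x y ≡ just d

  Spanning-refl : ∀ {n} (G : Graph flip n) → Spanning G G
  Spanning-refl G = record { V≡ = λ _ → refl ; E⊆ = λ _ _ _ Exy → Exy }

  Spanning⇒⊑ : ∀ {n} {G H : Graph flip n} → Spanning G H → _⊑_ flip H G
  Spanning⇒⊑ sp = record { V⊆ = λ x Hx → trans (sym (Spanning.V≡ sp x)) Hx ; E⊆ = Spanning.E⊆ sp }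

  graft : ∀ {n} (G : Graph flip n) (W : Fin n → Bool) (H : Graph flip n) →
          (∀ x → V H x ≡ true → V G x ≡ true) → Graph flip n
  graft {n} G W H H⊆G = record { V = V G ; E = E′ ; irrefl = irrefl′ ; E-sym = E-sym′ ; E-V = E-V′ }
    where
    E′ : Fin n → Fin n → Maybe (Fin k)
    E′ x y = if W x ∧ W y then E H x y else E G x y
    irrefl′ : ∀ x → E′ x x ≡ nothing
    irrefl′ x with W x ∧ W x
    ... | true  = irrefl H x
    ... | false = irrefl G x
    E-sym′ : ∀ x y → E′ y x ≡ Maybe.map flip (E′ x y)
    E-sym′ x y rewrite Bool.∧-comm (W y) (W x) with W x ∧ W y
    ... | true  = E-sym H x y
    ... | false = E-sym G x y
    E-V′ : ∀ x y d → E′ x y ≡ just d → V G x ≡ true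
    E-V′ x y d with W x ∧ W y
    ... | true  = H⊆G x ∘ E-V H x y d
    ... | false = E-V G x y d

  module _ {n} (G : Graph flip n) (W : Fin n → Bool) (H : Graph flip n)
           (H⊆G : ∀ x → V H x ≡ true → V G x ≡ true) where

    graft-inside : ∀ {x y} → W x ≡ true → W y ≡ true → E (graft G W H H⊆G) x y ≡ E H x y
    graft-inside Wx Wy rewrite Wx | Wy = refl

    graft-outside : ∀ {x} y → W x ≡ false → E (graft G W H H⊆G) x y ≡ E G x y
    graft-outside y Wx rewrite Wx = refl

    graft-E⊆ : (∀ x y d → E H x y ≡ just d → E G x y ≡ just d) →
               ∀ x y d → E (graft G W H H⊆G) x y ≡ just d → E G x y ≡ just d
    graft-E⊆ EH⊆EG x y d with W x ∧ W y
    ... | true  = EH⊆EG x y d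
    ... | false = id

  IsK⇒TwoLeast : ∀ {n} (G : Graph flip n) {i} → IsK flip (2 + i) G → TwoLeast (V G) i
  IsK⇒TwoLeast G {i} (#V≡2+i , _) = twoLeast (V G) i (trans (sym (vertexCount≡count G)) #V≡2+i)

  module TwoVertexSplit {n} (G : Graph flip n) (complete : Complete G) {i} (uv : TwoLeast (V G) i) where
    open TwoLeast uv

    S : Fin n → Bool
    S = pair u v

    S-u : S u ≡ true
    S-u = pair-left u v

    S-v : S v ≡ true
    S-v = pair-right u v

    rest : Graph flip n
    rest = induced flip G (λ x → not (S x))

    rest-IsK : IsK flip i rest
    rest-IsK = trans (vertexCount≡count rest) rest-count , induced-complete G _ complete

    pair-IsK : IsK flip 2 (induced flip G S)
    pair-IsK = trans (vertexCount≡count (induced flip G S)) pair-count , induced-complete G S complete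

    2i≤crossCount : (K : Graph flip n) → (∀ {x} y → S x ≡ true → E K x y ≡ E G x y) → 2 ℕ.* i ≤ crossCount flip K S
    2i≤crossCount K agree = begin
      2 ℕ.* i                                    ≡⟨ cong (i +_) (ℕ.+-identityʳ i) ⟩
      i + i                                      ≡⟨ cong₂ _+_ rest-count rest-count ⟨
      count R + count R                          ≤⟨ ℕ.+-mono-≤ (row P-u S-u proj₁) (row P-v S-v proj₂) ⟩
      ∑ (crossTerm K S u) + ∑ (crossTerm K S v)  ≤⟨ +-≤-∑ (λ x → ∑ (crossTerm K S x)) u≢v ⟩
      ∑ (λ x → ∑ (crossTerm K S x))              ≡⟨ crossCount≡∑ K S ⟨
      crossCount flip K S                        ∎
      where
      open ℕ.≤-Reasoning
      R : Fin n → Bool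
      R x = V G x ∧ not (S x)
      row : ∀ {w} → V G w ≡ true → S w ≡ true → (∀ {y} → toℕ u < toℕ y × toℕ v < toℕ y → toℕ w < toℕ y) →
            count R ≤ ∑ (crossTerm K S w)
      row {w} Gw Sw pick = count≤crossRow K S R Sw λ y Ry →
        let Gy , y∉S = ∧≡true⇒ Ry
            w<y = pick (precede y Ry)
            d , Ewy = complete w y Gw Gy (Fin.<⇒≢ w<y)
        in Bool.not-injective y∉S , w<y , d , trans (agree y Sw) Ewy

    1+2i≤edgeCount : suc (2 ℕ.* i) ≤ edgeCount flip G
    1+2i≤edgeCount = begin
      suc (2 ℕ.* i)                                    ≤⟨ s≤s (2i≤crossCount G (λ _ _ → refl)) ⟩
      suc (crossCount flip G S)                        ≤⟨ s≤s (ℕ.m≤n+m _ _) ⟩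
      suc (edgeCount flip rest + crossCount flip G S)  ≤⟨ edgeCount-split-≥ G S S-u S-v u≢v (complete u v P-u P-v u≢v) ⟩
      edgeCount flip G                                 ∎
      where open ℕ.≤-Reasoning

    module Extension (Π : Property flip) (isoC : IsoClosed flip Π) (incl : Inclusive flip Π)
                     (lam : ℝ) (sext : StrongExt flip lam Π)
                     (HW : Graph flip n) (HW-spans : Spanning rest HW) where
      open Spanning HW-spans

      W : Fin n → Bool
      W x = not (S x)

      HW⊆G : ∀ x → V HW x ≡ true → V G x ≡ true
      HW⊆G x HWx = proj₁ (∧≡true⇒ (trans (sym (V≡ x)) HWx))

      HW⊆W : ∀ x → V HW x ≡ true → W x ≡ true
      HW⊆W x HWx = proj₂ (∧≡true⇒ (trans (sym (V≡ x)) HWx))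

      G′ : Graph flip n
      G′ = graft G W HW HW⊆G

      G′-outside : ∀ {x} y → S x ≡ true → E G′ x y ≡ E G x y
      G′-outside y Sx = graft-outside G W HW HW⊆G y (cong not Sx)

      G′-inside : ∀ {x y} → W x ≡ true → W y ≡ true → E G′ x y ≡ E HW x y
      G′-inside = graft-inside G W HW HW⊆G

      Π-G′[S] : Π (induced flip G′ S)
      Π-G′[S] = isoC (induced flip G S) (induced flip G′ S) (Iso-≗ (λ _ → refl) agree) (incl _ (inj₂ pair-IsK))
        where
        agree : ∀ x y → V G x ∧ S x ≡ true → V G y ∧ S y ≡ true →
                E (induced flip G′ S) x y ≡ E (induced flip G S) x y
        agree x y x∈ y∈ =
          let Sx = proj₂ (∧≡true⇒ x∈)
              Sy = proj₂ (∧≡true⇒ y∈)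
          in trans (induced-E G′ S {x} {y} Sx Sy) (trans (G′-outside y Sx) (sym (induced-E G S {x} {y} Sx Sy)))

      Π-G′[W] : Π HW → Π (induced flip G′ W)
      Π-G′[W] = isoC HW (induced flip G′ W) (Iso-≗ V≡ λ x y HWx HWy →
        trans (induced-E G′ W {x} {y} (HW⊆W x HWx) (HW⊆W y HWy)) (G′-inside {x} {y} (HW⊆W x HWx) (HW⊆W y HWy)))

      extend : Π HW → Σ (Graph flip n) λ H → Spanning G H × Π H ×
               Σ ℕ λ c → MulLe lam (2 ℕ.* i) c × suc (edgeCount flip HW + c) ≤ edgeCount flip H
      extend ΠHW with sext G′ S Π-G′[S] (Π-G′[W] ΠHW)
      ... | H , H-del , lamK≤c , ΠH = H , H-spans , ΠH , crossCount flip H S , lam2i≤c , edges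
        where
        open DeleteCross H-del
        H-spans : Spanning G H
        H-spans = record
          { V≡ = sameV
          ; E⊆ = λ x y d → graft-E⊆ G W HW HW⊆G (λ x y d → induced-E⊆ G W ∘ E⊆ x y d) x y d ∘ crossSub x y d }
        lam2i≤c : MulLe lam (2 ℕ.* i) (crossCount flip H S)
        lam2i≤c = MulLe-antitone lam {k = crossCount flip H S} (2i≤crossCount G′ G′-outside) lamK≤c
        H[W]≗HW : ∀ x y → E (induced flip H W) x y ≡ E HW x y
        H[W]≗HW = induced-≗ H HW W HW⊆W λ x y Wx Wy →
          trans (sameIn x y (Bool.not-injective (trans Wx (sym Wy)))) (G′-inside Wx Wy)
        H-uv : Adjacent H u v
        H-uv = let d , Euv = complete u v P-u P-v u≢v in
          d , trans (sameIn u v (trans S-u (sym S-v))) (trans (G′-outside v S-u) Euv)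
        edges : suc (edgeCount flip HW + crossCount flip H S) ≤ edgeCount flip H
        edges = subst (λ e → suc (e + crossCount flip H S) ≤ edgeCount flip H)
                      (edgeCount-cong {G = induced flip H W} {HW} H[W]≗HW)
                      (edgeCount-split-≥ H S S-u S-v u≢v H-uv)

module _ {k : ℕ} {flip : Fin k → Fin k} (Π : Property flip) (isoC : IsoClosed flip Π) (incl : Inclusive flip Π)
         (lam : ℝ) (0<lam<1 : InOpenUnit lam) (sext : StrongExt flip lam Π)
         (apart∨K₃ : Apart½ lam ⊎ K3In flip Π) where

  LargeΠSubgraph : ℕ → ∀ {n} → Graph flip n → Set
  LargeΠSubgraph j {n} G = Σ (Graph flip n) λ H → Spanning G H × Π H × ExPositive lam j (edgeCount flip H)

  largeΠSubgraph : ∀ i {n} (G : Graph flip n) → IsK flip (2 + i) G → LargeΠSubgraph (2 + i) G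
  largeΠSubgraph zero G G-K₂ =
    G , Spanning-refl G , incl G (inj₂ G-K₂) , ExPositive-mono lam 2 1+2i≤edgeCount (ExPositive-2 lam 0<lam<1)
    where open TwoVertexSplit G (proj₂ G-K₂) (IsK⇒TwoLeast G G-K₂)
  largeΠSubgraph (suc zero) G G-K₃ = triangle apart∨K₃
    where
    open TwoVertexSplit G (proj₂ G-K₃) (IsK⇒TwoLeast G G-K₃)
    open Extension Π isoC incl lam sext rest (Spanning-refl rest)
    triangle : Apart½ lam ⊎ K3In flip Π → LargeΠSubgraph 3 G
    triangle (inj₂ K₃∈Π) =
      G , Spanning-refl G , K₃∈Π G G-K₃ , ExPositive-mono lam 3 1+2i≤edgeCount (ExPositive-3 lam 0<lam<1)
    triangle (inj₁ apart) =
      let H , H-spans , ΠH , c , lam2≤c , 1+#rest+c≤#H = extend (incl rest (inj₁ rest-IsK))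
      in H , H-spans , ΠH , ExPositive-mono lam 3 (ℕ.≤-trans (s≤s (ℕ.m≤n+m c _)) 1+#rest+c≤#H)
                                                 (ExPositive-3-apart lam 0<lam<1 {c} apart lam2≤c)
  largeΠSubgraph (suc (suc i)) G G-K =
    let HW , HW-spans , ΠHW , HW-large = largeΠSubgraph i rest rest-IsK
        H , H-spans , ΠH , c , lamK≤c , 1+#HW+c≤#H = Extension.extend Π isoC incl lam sext HW HW-spans ΠHW
    in H , H-spans , ΠH , ExPositive-mono lam (4 + i) 1+#HW+c≤#H
                            (ExPositive-suc-suc lam 0<lam<1 (suc i) {edgeCount flip HW} {c} HW-large lamK≤c)
    where open TwoVertexSplit G (proj₂ G-K) (IsK⇒TwoLeast G G-K)

mainTheorem2 : (k : ℕ) (flip : Fin k → Fin k) → (∀ d → flip (flip d) ≡ d) →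
    (lam : ℝ) → InOpenUnit lam →
    (Π : Property flip) → StronglyExtendible flip lam Π →
    Apart½ lam ⊎ K3In flip Π →
    ∀ (i : ℕ) → 2 ≤ i → ∀ (b : ℕ) → IsBetaK flip Π i b → ExPositive lam i b
mainTheorem2 k flip _ lam 0<lam<1 Π (isoC , incl , _ , sext) apart∨K₃ (suc (suc i)) (s≤s (s≤s _)) b
             ((_ , G , G-K , _ , maximal) , _) =
  let H , H-spans , ΠH , H-large = largeΠSubgraph Π isoC incl lam 0<lam<1 sext apart∨K₃ i G G-K
  in ExPositive-mono lam (2 + i) (maximal H (Spanning⇒⊑ H-spans) ΠH) H-large
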